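{- Let $p$ be a prime, $n\ge 2$, $F,G:\mathbb{F}_p^n\rightarrow\mathbb{F}_p^n$, and $\mathcal{E}=\{e_1,\dots,e_n\}$ a basis of $\mathbb{F}_p^n$ over $\mathbb{F}_p$, with coordinates $x_1,\dots,x_n$ relative to $\mathcal{E}$. Then \[ \Delta_{e_1} F(x_1,\dots,x_n) = \Delta_{e_2} G(x_1,\dots,x_n) \quad \forall (x_1,\dots,x_n)\in\mathbb{F}_p^n\] if and only if for every nonzero $\mu\in\mathbb{F}_p^n$, the algebraic normal forms \[\mu \cdot F(x_1,\dots,x_n) = \sum_{(i_1,\dots,i_n)} f_{(i_1,\dots,i_n)}^{(\mu)} \prod_{j=1}^n x_j^{i_j},\qquad \mu \cdot G(x_1,\dots,x_n) = \sum_{(i_1,\dots,i_n)} g_{(i_1,\dots,i_n)}^{(\mu)} \prod_{j=1}^n x_j^{i_j}\] (sums over $(i_1,\dots,i_n)\in\{0,\dots,p-1\}^n$) satisfy \[ \sum_{k=i_1+1}^{p-1} \binom{k}{k-i_1} f_{(k,i_2,i_3,\dots,i_n)}^{(\mu)} = \sum_{k=i_2+1}^{p-1} \binom{k}{k-i_2} g_{(i_1,k,i_3,\dots,i_n)}^{(\mu)}\] for all $i_1,i_2\in\{0,\dots,p-2\}$ and $(i_3,\dots,i_n)\in\{0,\dots,p-1\}^{n-2}$, and \[ \sum_{k=j+1}^{p-1} \binom{k}{k-j} f_{(k,p-1,i_3,\dots,i_n)}^{(\mu)} = \sum_{k=j+1}^{p-1} \binom{k}{k-j} g_{(p-1,k,i_3,\dots,i_n)}^{(\mu)}=0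 \] for all $j\in\{0,\dots,p-2\}$ and $(i_3,\dots,i_n)\in\{0,\dots,p-1\}^{n-2}$.
   Context: $\Delta_{a}F(x)=F(x+a)-F(x)$. For $\mu\in\mathbb{F}_p^n$, $\mu\cdot F$ denotes the component function $x\mapsto\sum_k\mu_kF_k(x)$ (with $F_k$ the coordinates of $F$). Every function $\mathbb{F}_p^n\to\mathbb{F}_p$, written in the coordinates $x_1,\dots,x_n$ relative to $\mathcal{E}$, has a unique algebraic normal form as a polynomial with coefficients in $\mathbb{F}_p$ and exponents in $\{0,\dots,p-1\}$ in each variable. Binomial coefficients are read in $\mathbb{F}_p$. -}

module Defs where

import Data.Nat
open import Data.Nat using (ℕ; zero; suc; _∸_; _<_; NonZero; nonTrivial⇒nonZero) renaming (_+_ to _+ℕ_)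
open import Data.Nat.DivMod using (_%_; m%n<n)
open import Data.Nat.Primality using (Prime)
open import Data.Nat.Combinatorics using (_C_)
open import Data.Fin using (Fin; toℕ; fromℕ<) renaming (zero to fz; suc to fs)
open import Data.Fin.Properties using (_<?_)
open import Data.Vec using (Vec; []; _∷_; replicate; zipWith; foldr)
open import Data.Product using (Σ; _×_)
open import Relation.Binary.PropositionalEquality using (_≡_)
import Data.Vec
open import Data.Bool using (if_then_else_)
open import Relation.Nullary.Decidable using (⌊_⌋)

module FpOps (p : ℕ) (pr : Prime p) where

  private
    nz : Prime p → NonZero p
    nz (Data.Nat.Primality.prime _) = nonTrivial⇒nonZero p
    instance
      nzp : NonZero p
      nzp = nz pr

  Fp : Set
  Fp = Fin p

  [_] : ℕ → Fp
  [ k ] = fromℕ< (m%n<n k p)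

  0ₚ 1ₚ : Fp
  0ₚ = [ 0 ]
  1ₚ = [ 1 ]

  pm1 : Fin p
  pm1 = [ p ∸ 1 ]

  infixl 6 _+ₚ_ _-ₚ_
  infixl 7 _*ₚ_
  _+ₚ_ _-ₚ_ _*ₚ_ : Fp → Fp → Fp
  a +ₚ b = [ toℕ a +ℕ toℕ b ]
  a -ₚ b = [ toℕ a +ℕ (p ∸ toℕ b) ]
  a *ₚ b = [ toℕ a Data.Nat.* toℕ b ]

  _^ₚ_ : Fp → ℕ → Fp
  a ^ₚ zero = 1ₚ
  a ^ₚ suc k = a *ₚ (a ^ₚ k)

  sumFin : ∀ {k} → (Fin k → Fp) → Fp
  sumFin {zero} f = 0ₚ
  sumFin {suc k} f = f fz +ₚ sumFin (λ i → f (fs i))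

  sumAbove : Fin p → (Fin p → Fp) → Fp
  sumAbove i h = sumFin (λ k → if ⌊ i <? k ⌋ then h k else 0ₚ)

  Vecₚ : ℕ → Set
  Vecₚ n = Vec Fp n

  0ᵥ : ∀ {n} → Vecₚ n
  0ᵥ = replicate _ 0ₚ

  _+ᵥ_ _-ᵥ_ : ∀ {n} → Vecₚ n → Vecₚ n → Vecₚ n
  u +ᵥ v = zipWith _+ₚ_ u v
  u -ᵥ v = zipWith _-ₚ_ u v

  _·ᵥ_ : Fp → ∀ {n} → Vecₚ n → Vecₚ n
  a ·ᵥ v = Data.Vec.map (a *ₚ_) v

  dot : ∀ {n} → Vecₚ n → Vecₚ n → Fp
  dot u v = foldr _ _+ₚ_ 0ₚ (zipWith _*ₚ_ u v)

  -- the point with coordinates c relative to the family e:  Σ_i c_i e_i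
  lin : ∀ {n m} → Vec Fp m → Vec (Vecₚ n) m → Vecₚ n
  lin [] [] = 0ᵥ
  lin (c ∷ cs) (v ∷ vs) = (c ·ᵥ v) +ᵥ lin cs vs

  IsBasis : ∀ {n} → Vec (Vecₚ n) n → Set
  IsBasis {n} e =
    ((v : Vecₚ n) → Σ (Vec Fp n) (λ c → lin c e ≡ v)) ×
    ((c c' : Vec Fp n) → lin c e ≡ lin c' e → c ≡ c')

  Δ : ∀ {n} → Vecₚ n → (Vecₚ n → Vecₚ n) → Vecₚ n → Vecₚ n
  Δ a F x = F (x +ᵥ a) -ᵥ F x

  comp : ∀ {n} → Vecₚ n → (Vecₚ n → Vecₚ n) → Vecₚ n → Fp
  comp μ F x = dot μ (F x)

  sumMulti : ∀ n → (Vec (Fin p) n → Fp) → Fp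
  sumMulti zero g = g []
  sumMulti (suc n) g = sumFin (λ a → sumMulti n (λ r → g (a ∷ r)))

  monomial : ∀ {n} → Vec (Fin p) n → Vec Fp n → Fp
  monomial [] [] = 1ₚ
  monomial (i ∷ is) (x ∷ xs) = (x ^ₚ toℕ i) *ₚ monomial is xs

  IsANF : ∀ {n} → (Vec (Fin p) n → Fp) → (Vec Fp n → Fp) → Set
  IsANF {n} f h = (x : Vec Fp n) → h x ≡ sumMulti n (λ i → f i *ₚ monomial i x)

  binom : ℕ → ℕ → Fp
  binom a b = [ a C b ]

  binomSum : Fin p → (Fin p → Fp) → Fp
  binomSum i h = sumAbove i (λ k → binom (toℕ k) (toℕ k ∸ toℕ i) *ₚ h k)

-- The difference Δ_{e₁}F or Δ_{e₂}G, read through a component μ and the coordinates x = Σ xⱼ eⱼ, is a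
-- difference in the first or second coordinate of a function F_p^n → F_p. By the binomial theorem,
-- (x + 1)^k - x^k = Σ_{i<k} C(k, k-i) x^i, so such a difference has ANF coefficients
-- Σ_{k>i₁} C(k, k-i₁) f_(k,i₂,…) (resp. the same sum in the second index of g). As the ANF is unique,
-- the two differences agree for every component exactly when these coefficient families agree, and the
-- unit vectors μ already give equality of the vectors. At index p - 1 the sums are empty, which turns
-- the agreement of the coefficient families into the two families of conditions of the theorem.
--
-- Existence and uniqueness of the ANF reduce, one variable at a time, to univariate polynomials of
-- degree < p on the p points of F_p: uniqueness by the factor theorem, existence by Newton interpolation.
module Submission where

open import Algebra.Bundles using (CommutativeRing)
open import Algebra.Structures using (IsCommutativeRing)
import Algebra.Properties.Ring as RingProperties
import Algebra.Solver.Ring.NaturalCoefficients.Default as Solver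
open import Data.Bool using (true; false; if_then_else_; T)
open import Data.Empty using (⊥-elim)
open import Data.Fin using (Fin; toℕ) renaming (zero to fz; suc to fs)
open import Data.Fin.Properties using (toℕ-fromℕ<; toℕ-injective; toℕ<n; suc-injective; 0≢1+n; _<?_)
open import Data.Nat as ℕ using (ℕ; zero; suc; _∸_; _<_; NonZero; s≤s)
import Data.Nat.Properties as ℕ
open import Data.Nat.Combinatorics using (_C_; nCk≡nC[n∸k]; nCn≡1; k>n⇒nCk≡0; nCk+nC[k+1]≡[n+1]C[k+1])
open import Data.Nat.Coprimality using (prime⇒coprime; coprime-Bézout)
open import Data.Nat.DivMod using (_%_; %-distribˡ-+; %-distribˡ-*; m%n%n≡m%n; m<n⇒m%n≡m; n%n≡0; m*n%n≡0)
open import Data.Nat.GCD using (module Bézout)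
open import Data.Nat.Primality using (Prime; prime⇒nonZero; prime⇒nonTrivial)
open import Data.Product using (Σ; _×_; _,_; proj₁; proj₂)
open import Data.Sum using (_⊎_; inj₁; inj₂)
open import Data.Unit using (tt)
open import Data.Vec using (Vec; []; _∷_; lookup; tabulate; _[_]≔_)
import Data.Vec.Functional as Vector
open import Data.Vec.Properties using (lookup∘update; lookup-replicate; tabulate∘lookup; tabulate-cong; zipWith-assoc)
open import Function using (_∘_; id)
open import Function.Bundles using (_⇔_; mk⇔; Equivalence)
open import Function.Definitions using (Injective)
open import Level using (0ℓ)
open import Relation.Binary.PropositionalEquality hiding ([_])
open import Relation.Nullary using (yes; no)
open import Relation.Nullary.Decidable using (⌊_⌋)

open import Defs

module _ (p : ℕ) (pr : Prime p) where
  open FpOps p pr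
  open ≡-Reasoning

  private instance
    p≢0 : NonZero p
    p≢0 = prime⇒nonZero pr

  toℕ-[] : ∀ a → toℕ [ a ] ≡ a % p
  toℕ-[] a = toℕ-fromℕ< _

  []-cong% : ∀ {a b} → a % p ≡ b % p → [ a ] ≡ [ b ]
  []-cong% eq = toℕ-injective (trans (toℕ-[] _) (trans eq (sym (toℕ-[] _))))

  []-toℕ : ∀ x → [ toℕ x ] ≡ x
  []-toℕ x = toℕ-injective (trans (toℕ-[] _) (m<n⇒m%n≡m (toℕ<n x)))

  reduce-+ˡ : ∀ a b → [ toℕ [ a ] ℕ.+ b ] ≡ [ a ℕ.+ b ]
  reduce-+ˡ a b = []-cong% (begin
    (toℕ [ a ] ℕ.+ b) % p      ≡⟨ cong (λ t → (t ℕ.+ b) % p) (toℕ-[] a) ⟩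
    (a % p ℕ.+ b) % p          ≡⟨ %-distribˡ-+ (a % p) b p ⟩
    (a % p % p ℕ.+ b % p) % p  ≡⟨ cong (λ t → (t ℕ.+ b % p) % p) (m%n%n≡m%n a p) ⟩
    (a % p ℕ.+ b % p) % p      ≡⟨ %-distribˡ-+ a b p ⟨
    (a ℕ.+ b) % p              ∎)

  reduce-+ʳ : ∀ a b → [ a ℕ.+ toℕ [ b ] ] ≡ [ a ℕ.+ b ]
  reduce-+ʳ a b = trans (cong [_] (ℕ.+-comm a _)) (trans (reduce-+ˡ b a) (cong [_] (ℕ.+-comm b a)))

  reduce-*ˡ : ∀ a b → [ toℕ [ a ] ℕ.* b ] ≡ [ a ℕ.* b ]
  reduce-*ˡ a b = []-cong% (begin
    (toℕ [ a ] ℕ.* b) % p          ≡⟨ cong (λ t → (t ℕ.* b) % p) (toℕ-[] a) ⟩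
    (a % p ℕ.* b) % p              ≡⟨ %-distribˡ-* (a % p) b p ⟩
    (a % p % p ℕ.* (b % p)) % p    ≡⟨ cong (λ t → (t ℕ.* (b % p)) % p) (m%n%n≡m%n a p) ⟩
    (a % p ℕ.* (b % p)) % p        ≡⟨ %-distribˡ-* a b p ⟨
    (a ℕ.* b) % p                  ∎)

  reduce-*ʳ : ∀ a b → [ a ℕ.* toℕ [ b ] ] ≡ [ a ℕ.* b ]
  reduce-*ʳ a b = trans (cong [_] (ℕ.*-comm a _)) (trans (reduce-*ˡ b a) (cong [_] (ℕ.*-comm b a)))

  []-+ : ∀ a b → [ a ] +ₚ [ b ] ≡ [ a ℕ.+ b ]
  []-+ a b = trans (reduce-+ˡ a _) (reduce-+ʳ a b)

  []-* : ∀ a b → [ a ] *ₚ [ b ] ≡ [ a ℕ.* b ]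
  []-* a b = trans (reduce-*ˡ a _) (reduce-*ʳ a b)

  toℕ-0ₚ : toℕ 0ₚ ≡ 0
  toℕ-0ₚ = trans (toℕ-[] 0) (m<n⇒m%n≡m (ℕ.>-nonZero⁻¹ p))

  []-%≡0 : ∀ {a} → a % p ≡ 0 → [ a ] ≡ 0ₚ
  []-%≡0 a%p≡0 = toℕ-injective (trans (toℕ-[] _) (trans a%p≡0 (sym toℕ-0ₚ)))

  negₚ : Fp → Fp
  negₚ x = [ p ∸ toℕ x ]

  Fp-isCommutativeRing : IsCommutativeRing _≡_ _+ₚ_ _*ₚ_ negₚ 0ₚ 1ₚ
  Fp-isCommutativeRing = record
    { isRing = record
      { +-isAbelianGroup = record
        { isGroup = record
          { isMonoid = record
            { isSemigroup = record
              { isMagma = record { isEquivalence = isEquivalence ; ∙-cong = cong₂ _+ₚ_ }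
              ; assoc = +-assoc }
            ; identity = +-identityˡ , λ x → trans (+-comm x 0ₚ) (+-identityˡ x) }
          ; inverse = (λ x → trans (+-comm (negₚ x) x) (+-inverseʳ x)) , +-inverseʳ
          ; ⁻¹-cong = cong negₚ }
        ; comm = +-comm }
      ; *-cong = cong₂ _*ₚ_
      ; *-assoc = *-assoc
      ; *-identity = *-identityˡ , λ x → trans (*-comm x 1ₚ) (*-identityˡ x)
      ; distrib = distribˡ , λ x y z → trans (*-comm (y +ₚ z) x)
                    (trans (distribˡ x y z) (cong₂ _+ₚ_ (*-comm x y) (*-comm x z))) }
    ; *-comm = *-comm }
    where
    +-comm : ∀ x y → x +ₚ y ≡ y +ₚ x
    +-comm x y = cong [_] (ℕ.+-comm (toℕ x) _)
    *-comm : ∀ x y → x *ₚ y ≡ y *ₚ x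
    *-comm x y = cong [_] (ℕ.*-comm (toℕ x) _)
    +-assoc : ∀ x y z → (x +ₚ y) +ₚ z ≡ x +ₚ (y +ₚ z)
    +-assoc x y z = trans (reduce-+ˡ _ _) (trans (cong [_] (ℕ.+-assoc (toℕ x) _ _)) (sym (reduce-+ʳ (toℕ x) _)))
    *-assoc : ∀ x y z → (x *ₚ y) *ₚ z ≡ x *ₚ (y *ₚ z)
    *-assoc x y z = trans (reduce-*ˡ _ _) (trans (cong [_] (ℕ.*-assoc (toℕ x) _ _)) (sym (reduce-*ʳ (toℕ x) _)))
    +-identityˡ : ∀ x → 0ₚ +ₚ x ≡ x
    +-identityˡ x = trans (reduce-+ˡ 0 _) ([]-toℕ x)
    *-identityˡ : ∀ x → 1ₚ *ₚ x ≡ x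
    *-identityˡ x = trans (reduce-*ˡ 1 _) (trans (cong [_] (ℕ.*-identityˡ (toℕ x))) ([]-toℕ x))
    distribˡ : ∀ x y z → x *ₚ (y +ₚ z) ≡ x *ₚ y +ₚ x *ₚ z
    distribˡ x y z = begin
      [ toℕ x ℕ.* toℕ (y +ₚ z) ]                  ≡⟨ reduce-*ʳ (toℕ x) _ ⟩
      [ toℕ x ℕ.* (toℕ y ℕ.+ toℕ z) ]             ≡⟨ cong [_] (ℕ.*-distribˡ-+ (toℕ x) (toℕ y) _) ⟩
      [ toℕ x ℕ.* toℕ y ℕ.+ toℕ x ℕ.* toℕ z ]     ≡⟨ []-+ _ _ ⟨
      x *ₚ y +ₚ x *ₚ z                           ∎
    +-inverseʳ : ∀ x → x +ₚ negₚ x ≡ 0ₚ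
    +-inverseʳ x = begin
      [ toℕ x ℕ.+ toℕ (negₚ x) ]      ≡⟨ reduce-+ʳ (toℕ x) _ ⟩
      [ toℕ x ℕ.+ (p ∸ toℕ x) ]       ≡⟨ cong [_] (ℕ.m+[n∸m]≡n (ℕ.<⇒≤ (toℕ<n x))) ⟩
      [ p ]                           ≡⟨ []-%≡0 (n%n≡0 p) ⟩
      0ₚ                              ∎

  Fp-commutativeRing : CommutativeRing 0ℓ 0ℓ
  Fp-commutativeRing = record { isCommutativeRing = Fp-isCommutativeRing }

  open CommutativeRing Fp-commutativeRing
    using (-_; _-_; +-assoc; +-comm; +-identityˡ; +-identityʳ; -‿inverseʳ;
           *-assoc; *-comm; *-identityˡ; *-identityʳ; zeroˡ; zeroʳ; distribˡ)
  open RingProperties (CommutativeRing.ring Fp-commutativeRing)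
    using (-‿distribʳ-*; +-inverseˡ-unique; +-cancelˡ; +-cancelʳ; xyx⁻¹≈y; x∙y⁻¹≈ε⇒x≈y; -‿+-comm; x[y-z]≈xy-xz)
  open Solver (CommutativeRing.commutativeSemiring Fp-commutativeRing)
    using (solve; _:+_; _:*_; _:=_; con)

  -ₚ≡- : ∀ x y → x -ₚ y ≡ x - y
  -ₚ≡- x y = sym (reduce-+ʳ (toℕ x) (p ∸ toℕ y))

  1≢0 : 1ₚ ≢ 0ₚ
  1≢0 1≡0 = ℕ.1+n≢0 (begin
    1             ≡⟨ m<n⇒m%n≡m (ℕ.nonTrivial⇒n>1 p {{prime⇒nonTrivial pr}}) ⟨
    1 % p         ≡⟨ toℕ-[] 1 ⟨
    toℕ 1ₚ        ≡⟨ cong toℕ 1≡0 ⟩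
    toℕ 0ₚ        ≡⟨ toℕ-0ₚ ⟩
    0             ∎)

  x≢0⇒invertible : ∀ x → x ≢ 0ₚ → Σ Fp λ y → x *ₚ y ≡ 1ₚ
  x≢0⇒invertible x x≢0 = fromBézout (coprime-Bézout (prime⇒coprime pr (toℕ<n x)))
    where
    instance
      n≢0 : NonZero (toℕ x)
      n≢0 = ℕ.≢-nonZero λ n≡0 → x≢0 (toℕ-injective (trans n≡0 (sym toℕ-0ₚ)))
    n : ℕ
    n = toℕ x
    x*[b]≡[n*b] : ∀ b → x *ₚ [ b ] ≡ [ b ℕ.* n ]
    x*[b]≡[n*b] b = begin
      x *ₚ [ b ]        ≡⟨ cong (_*ₚ [ b ]) ([]-toℕ x) ⟨
      [ n ] *ₚ [ b ]    ≡⟨ []-* n b ⟩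
      [ n ℕ.* b ]       ≡⟨ cong [_] (ℕ.*-comm n b) ⟩
      [ b ℕ.* n ]       ∎
    fromBézout : Bézout.Identity 1 p n → Σ Fp λ y → x *ₚ y ≡ 1ₚ
    fromBézout (Bézout.-+ a b eq) = [ b ] , (begin
      x *ₚ [ b ]           ≡⟨ x*[b]≡[n*b] b ⟩
      [ b ℕ.* n ]          ≡⟨ cong [_] eq ⟨
      [ 1 ℕ.+ a ℕ.* p ]    ≡⟨ []-+ 1 (a ℕ.* p) ⟨
      1ₚ +ₚ [ a ℕ.* p ]    ≡⟨ cong (1ₚ +ₚ_) ([]-%≡0 (m*n%n≡0 a p)) ⟩
      1ₚ +ₚ 0ₚ             ≡⟨ +-identityʳ 1ₚ ⟩
      1ₚ                   ∎)
    fromBézout (Bézout.+- a b eq) = - [ b ] , (begin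
      x *ₚ - [ b ]         ≡⟨ -‿distribʳ-* x [ b ] ⟨
      - (x *ₚ [ b ])       ≡⟨ cong -_ (x*[b]≡[n*b] b) ⟩
      - [ b ℕ.* n ]        ≡⟨ +-inverseˡ-unique 1ₚ [ b ℕ.* n ] (begin
        1ₚ +ₚ [ b ℕ.* n ]    ≡⟨ []-+ 1 (b ℕ.* n) ⟩
        [ 1 ℕ.+ b ℕ.* n ]    ≡⟨ cong [_] eq ⟩
        [ a ℕ.* p ]          ≡⟨ []-%≡0 (m*n%n≡0 a p) ⟩
        0ₚ                   ∎) ⟨
      1ₚ                   ∎)

  *-cancelˡ-≢0 : ∀ {x y z} → x ≢ 0ₚ → x *ₚ y ≡ x *ₚ z → y ≡ z
  *-cancelˡ-≢0 {x} {y} {z} x≢0 xy≡xz = begin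
    y                    ≡⟨ undo y ⟨
    x⁻¹ *ₚ (x *ₚ y)      ≡⟨ cong (x⁻¹ *ₚ_) xy≡xz ⟩
    x⁻¹ *ₚ (x *ₚ z)      ≡⟨ undo z ⟩
    z                    ∎
    where
    x⁻¹ : Fp
    x⁻¹ = proj₁ (x≢0⇒invertible x x≢0)
    undo : ∀ w → x⁻¹ *ₚ (x *ₚ w) ≡ w
    undo w = begin
      x⁻¹ *ₚ (x *ₚ w)    ≡⟨ solve 3 (λ x x⁻¹ w → x⁻¹ :* (x :* w) := (x :* x⁻¹) :* w) refl x x⁻¹ w ⟩
      (x *ₚ x⁻¹) *ₚ w    ≡⟨ cong (_*ₚ w) (proj₂ (x≢0⇒invertible x x≢0)) ⟩
      1ₚ *ₚ w            ≡⟨ *-identityˡ w ⟩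
      w                  ∎

  *-≢0 : ∀ {x y} → x ≢ 0ₚ → y ≢ 0ₚ → x *ₚ y ≢ 0ₚ
  *-≢0 {x} x≢0 y≢0 xy≡0 = y≢0 (*-cancelˡ-≢0 x≢0 (trans xy≡0 (sym (zeroʳ x))))

  x-y≢0 : ∀ {x y} → x ≢ y → x - y ≢ 0ₚ
  x-y≢0 {x} {y} x≢y x-y≡0 = x≢y (x∙y⁻¹≈ε⇒x≈y x y x-y≡0)

  x+[y-x]≡y : ∀ x y → x +ₚ (y - x) ≡ y
  x+[y-x]≡y x y = trans (sym (+-assoc x y (- x))) (xyx⁻¹≈y x y)

  sumFin-cong : ∀ {k} {f g : Fin k → Fp} → (∀ i → f i ≡ g i) → sumFin f ≡ sumFin g
  sumFin-cong {zero}  f≗g = refl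
  sumFin-cong {suc k} f≗g = cong₂ _+ₚ_ (f≗g fz) (sumFin-cong (f≗g ∘ fs))

  sumFin-zero : ∀ k → sumFin {k} (λ _ → 0ₚ) ≡ 0ₚ
  sumFin-zero zero    = refl
  sumFin-zero (suc k) = trans (+-identityˡ _) (sumFin-zero k)

  sumFin-distrib-+ : ∀ {k} (f g : Fin k → Fp) → sumFin (λ i → f i +ₚ g i) ≡ sumFin f +ₚ sumFin g
  sumFin-distrib-+ {zero}  f g = sym (+-identityˡ 0ₚ)
  sumFin-distrib-+ {suc k} f g = trans (cong (f fz +ₚ g fz +ₚ_) (sumFin-distrib-+ (f ∘ fs) (g ∘ fs)))
    (solve 4 (λ a b c d → (a :+ b) :+ (c :+ d) := (a :+ c) :+ (b :+ d)) refl (f fz) (g fz) _ _)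

  *-distribˡ-sumFin : ∀ {k} c (f : Fin k → Fp) → c *ₚ sumFin f ≡ sumFin (λ i → c *ₚ f i)
  *-distribˡ-sumFin {zero}  c f = zeroʳ c
  *-distribˡ-sumFin {suc k} c f = trans (distribˡ c (f fz) _) (cong (c *ₚ f fz +ₚ_) (*-distribˡ-sumFin c (f ∘ fs)))

  *-distribʳ-sumFin : ∀ {k} c (f : Fin k → Fp) → sumFin f *ₚ c ≡ sumFin (λ i → f i *ₚ c)
  *-distribʳ-sumFin c f = trans (*-comm (sumFin f) c) (trans (*-distribˡ-sumFin c f) (sumFin-cong λ i → *-comm c (f i)))

  sumFin-comm : ∀ {k l} (f : Fin k → Fin l → Fp) →
                sumFin (λ i → sumFin (f i)) ≡ sumFin (λ j → sumFin (λ i → f i j))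
  sumFin-comm {zero}  {l} f = sym (sumFin-zero l)
  sumFin-comm {suc k} {l} f = trans (cong (sumFin (f fz) +ₚ_) (sumFin-comm (f ∘ fs)))
    (sym (sumFin-distrib-+ (f fz) _))

  -- Polynomials in one variable, in Horner form

  eval : ∀ {k} → (Fin k → Fp) → Fp → Fp
  eval {zero}  c x = 0ₚ
  eval {suc k} c x = c fz +ₚ x *ₚ eval (c ∘ fs) x

  eval-cong : ∀ {k} {c d : Fin k → Fp} → (∀ i → c i ≡ d i) → ∀ x → eval c x ≡ eval d x
  eval-cong {zero}  c≗d x = refl
  eval-cong {suc k} c≗d x = cong₂ (λ u v → u +ₚ x *ₚ v) (c≗d fz) (eval-cong (c≗d ∘ fs) x)

  eval-zero : ∀ k x → eval {k} (λ _ → 0ₚ) x ≡ 0ₚ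
  eval-zero zero    x = refl
  eval-zero (suc k) x = trans (cong (λ v → 0ₚ +ₚ x *ₚ v) (eval-zero k x))
    (solve 1 (λ x → con 0 :+ x :* con 0 := con 0) refl x)

  eval-+ : ∀ {k} (c d : Fin k → Fp) x → eval (λ i → c i +ₚ d i) x ≡ eval c x +ₚ eval d x
  eval-+ {zero}  c d x = sym (+-identityˡ 0ₚ)
  eval-+ {suc k} c d x = trans (cong (λ v → c fz +ₚ d fz +ₚ x *ₚ v) (eval-+ (c ∘ fs) (d ∘ fs) x))
    (solve 5 (λ a b x u v → (a :+ b) :+ x :* (u :+ v) := (a :+ x :* u) :+ (b :+ x :* v)) refl
      (c fz) (d fz) x (eval (c ∘ fs) x) (eval (d ∘ fs) x))

  eval-* : ∀ {k} s (c : Fin k → Fp) x → eval (λ i → s *ₚ c i) x ≡ s *ₚ eval c x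
  eval-* {zero}  s c x = sym (zeroʳ s)
  eval-* {suc k} s c x = trans (cong (λ v → s *ₚ c fz +ₚ x *ₚ v) (eval-* s (c ∘ fs) x))
    (solve 4 (λ s a x u → s :* a :+ x :* (s :* u) := s :* (a :+ x :* u)) refl s (c fz) x (eval (c ∘ fs) x))

  eval≡Σ : ∀ {k} (c : Fin k → Fp) x → eval c x ≡ sumFin (λ i → c i *ₚ x ^ₚ toℕ i)
  eval≡Σ {zero}  c x = refl
  eval≡Σ {suc k} c x = cong₂ _+ₚ_ (sym (*-identityʳ (c fz))) (begin
    x *ₚ eval (c ∘ fs) x
      ≡⟨ cong (x *ₚ_) (eval≡Σ (c ∘ fs) x) ⟩
    x *ₚ sumFin (λ i → c (fs i) *ₚ x ^ₚ toℕ i)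
      ≡⟨ *-distribˡ-sumFin x (λ i → c (fs i) *ₚ x ^ₚ toℕ i) ⟩
    sumFin (λ i → x *ₚ (c (fs i) *ₚ x ^ₚ toℕ i))
      ≡⟨ sumFin-cong (λ i → solve 3 (λ x a u → x :* (a :* u) := a :* (x :* u)) refl x (c (fs i)) _) ⟩
    sumFin (λ i → c (fs i) *ₚ (x *ₚ x ^ₚ toℕ i)) ∎)

  quotient : ∀ {k} → Fp → (Fin (suc k) → Fp) → Fin k → Fp
  quotient {suc k} a c fz     = eval (c ∘ fs) a
  quotient {suc k} a c (fs i) = quotient a (c ∘ fs) i

  eval-quotient-+ : ∀ {k} a (c : Fin (suc k) → Fp) d →
                    eval c (a +ₚ d) ≡ eval c a +ₚ d *ₚ eval (quotient a c) (a +ₚ d)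
  eval-quotient-+ {zero}  a c d =
    solve 3 (λ c a d → c :+ (a :+ d) :* con 0 := (c :+ a :* con 0) :+ d :* con 0) refl (c fz) a d
  eval-quotient-+ {suc k} a c d = trans (cong (λ v → c fz +ₚ (a +ₚ d) *ₚ v) (eval-quotient-+ a (c ∘ fs) d))
    (solve 5 (λ c a d r q → c :+ (a :+ d) :* (r :+ d :* q) := (c :+ a :* r) :+ d :* (r :+ (a :+ d) :* q)) refl
      (c fz) a d (eval (c ∘ fs) a) (eval (quotient a (c ∘ fs)) (a +ₚ d)))

  eval-quotient : ∀ {k} a (c : Fin (suc k) → Fp) x →
                  eval c x ≡ eval c a +ₚ (x - a) *ₚ eval (quotient a c) x
  eval-quotient a c x = subst (λ y → eval c y ≡ eval c a +ₚ (x - a) *ₚ eval (quotient a c) y)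
    (x+[y-x]≡y a x) (eval-quotient-+ a c (x - a))

  ≡-from-quotient : ∀ {k} a (c d : Fin (suc k) → Fp) → eval c a ≡ eval d a →
                    (∀ i → quotient a c i ≡ quotient a d i) → ∀ i → c i ≡ d i
  ≡-from-quotient {zero}  a c d ca≡da q≗ fz = +-cancelʳ (a *ₚ 0ₚ) (c fz) (d fz) ca≡da
  ≡-from-quotient {suc k} a c d ca≡da q≗ fz =
    +-cancelʳ (a *ₚ eval (c ∘ fs) a) (c fz) (d fz) (trans ca≡da (cong (λ v → d fz +ₚ a *ₚ v) (sym (q≗ fz))))
  ≡-from-quotient {suc k} a c d ca≡da q≗ (fs i) = ≡-from-quotient a (c ∘ fs) (d ∘ fs) (q≗ fz) (q≗ ∘ fs) i

  interpolation-unique : ∀ {k} (pts : Fin k → Fp) → Injective _≡_ _≡_ pts → (c d : Fin k → Fp) →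
                         (∀ i → eval c (pts i) ≡ eval d (pts i)) → ∀ i → c i ≡ d i
  interpolation-unique {suc k} pts inj c d agree =
    ≡-from-quotient a c d (agree fz) (interpolation-unique (pts ∘ fs) (suc-injective ∘ inj) _ _ quotients-agree)
    where
    a : Fp
    a = pts fz
    quotients-agree : ∀ i → eval (quotient a c) (pts (fs i)) ≡ eval (quotient a d) (pts (fs i))
    quotients-agree i = *-cancelˡ-≢0 (x-y≢0 (λ b≡a → 0≢1+n (sym (inj b≡a))))
      (+-cancelˡ (eval c a) _ _ (begin
        eval c a +ₚ (b - a) *ₚ eval (quotient a c) b
          ≡⟨ eval-quotient a c b ⟨
        eval c b
          ≡⟨ agree (fs i) ⟩
        eval d b
          ≡⟨ eval-quotient a d b ⟩
        eval d a +ₚ (b - a) *ₚ eval (quotient a d) b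
          ≡⟨ cong (_+ₚ (b - a) *ₚ eval (quotient a d) b) (agree fz) ⟨
        eval c a +ₚ (b - a) *ₚ eval (quotient a d) b ∎))
      where
      b : Fp
      b = pts (fs i)

  pad : ∀ {k} → (Fin k → Fp) → Fin (suc k) → Fp
  pad {zero}  c = λ _ → 0ₚ
  pad {suc k} c = c fz Vector.∷ pad (c ∘ fs)

  eval-pad : ∀ {k} (c : Fin k → Fp) x → eval (pad c) x ≡ eval c x
  eval-pad {zero}  c x = solve 1 (λ x → con 0 :+ x :* con 0 := con 0) refl x
  eval-pad {suc k} c x = cong (λ v → c fz +ₚ x *ₚ v) (eval-pad (c ∘ fs) x)

  mulLinear : ∀ {k} → Fp → (Fin k → Fp) → Fin (suc k) → Fp
  mulLinear b c i = (0ₚ Vector.∷ c) i +ₚ (- b) *ₚ pad c i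

  eval-mulLinear : ∀ {k} b (c : Fin k → Fp) x → eval (mulLinear b c) x ≡ (x - b) *ₚ eval c x
  eval-mulLinear b c x = begin
    eval (mulLinear b c) x
      ≡⟨ eval-+ (0ₚ Vector.∷ c) (λ i → (- b) *ₚ pad c i) x ⟩
    eval (0ₚ Vector.∷ c) x +ₚ eval (λ i → (- b) *ₚ pad c i) x
      ≡⟨ cong (eval (0ₚ Vector.∷ c) x +ₚ_) (eval-* (- b) (pad c) x) ⟩
    0ₚ +ₚ x *ₚ eval c x +ₚ (- b) *ₚ eval (pad c) x
      ≡⟨ cong (λ v → 0ₚ +ₚ x *ₚ eval c x +ₚ (- b) *ₚ v) (eval-pad c x) ⟩
    0ₚ +ₚ x *ₚ eval c x +ₚ (- b) *ₚ eval c x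
      ≡⟨ solve 3 (λ x nb e → con 0 :+ x :* e :+ nb :* e := (x :+ nb) :* e) refl x (- b) (eval c x) ⟩
    (x - b) *ₚ eval c x                                        ∎

  vanishingAt : ∀ {k} → (Fin k → Fp) → Fin (suc k) → Fp
  vanishingAt {zero}  bs = λ _ → 1ₚ
  vanishingAt {suc k} bs = mulLinear (bs fz) (vanishingAt (bs ∘ fs))

  eval-vanishingAt : ∀ {k} (bs : Fin k → Fp) i → eval (vanishingAt bs) (bs i) ≡ 0ₚ
  eval-vanishingAt {suc k} bs i = begin
    eval (vanishingAt bs) (bs i)        ≡⟨ eval-mulLinear (bs fz) N (bs i) ⟩
    (bs i - bs fz) *ₚ eval N (bs i)     ≡⟨ vanishes i ⟩
    0ₚ                                  ∎
    where
    N : Fin (suc k) → Fp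
    N = vanishingAt (bs ∘ fs)
    vanishes : ∀ i → (bs i - bs fz) *ₚ eval N (bs i) ≡ 0ₚ
    vanishes fz     = trans (cong (_*ₚ eval N (bs fz)) (-‿inverseʳ (bs fz))) (zeroˡ _)
    vanishes (fs i) = trans (cong ((bs (fs i) - bs fz) *ₚ_) (eval-vanishingAt (bs ∘ fs) i)) (zeroʳ (bs (fs i) - bs fz))

  eval-vanishingAt-≢0 : ∀ {k} (bs : Fin k → Fp) a → (∀ i → bs i ≢ a) → eval (vanishingAt bs) a ≢ 0ₚ
  eval-vanishingAt-≢0 {zero}  bs a _ = 1≢0 ∘ trans (solve 1 (λ a → con 1 := con 1 :+ a :* con 0) refl a)
  eval-vanishingAt-≢0 {suc k} bs a bs≢a = subst (_≢ 0ₚ) (sym (eval-mulLinear (bs fz) (vanishingAt (bs ∘ fs)) a))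
    (*-≢0 (x-y≢0 (bs≢a fz ∘ sym)) (eval-vanishingAt-≢0 (bs ∘ fs) a (bs≢a ∘ fs)))

  -- Newton: add to an interpolant at the other points a multiple of their vanishing polynomial.
  interpolation-exists : ∀ {k} (pts : Fin k → Fp) → Injective _≡_ _≡_ pts → (h : Fp → Fp) →
                         Σ (Fin k → Fp) λ c → ∀ i → eval c (pts i) ≡ h (pts i)
  interpolation-exists {zero}  pts inj h = (λ ()) , (λ ())
  interpolation-exists {suc k} pts inj h = c , c-interpolates
    where
    a : Fp
    a = pts fz
    bs : Fin k → Fp
    bs = pts ∘ fs
    IH : Σ (Fin k → Fp) λ c′ → ∀ i → eval c′ (bs i) ≡ h (bs i)
    IH = interpolation-exists bs (suc-injective ∘ inj) h
    c′ : Fin k → Fp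
    c′ = proj₁ IH
    N : Fin (suc k) → Fp
    N = vanishingAt bs
    Na-invertible : Σ Fp λ y → eval N a *ₚ y ≡ 1ₚ
    Na-invertible = x≢0⇒invertible (eval N a) (eval-vanishingAt-≢0 bs a (λ i b≡a → 0≢1+n (sym (inj b≡a))))
    s : Fp
    s = (h a - eval c′ a) *ₚ proj₁ Na-invertible
    c : Fin (suc k) → Fp
    c i = pad c′ i +ₚ s *ₚ N i
    eval-c : ∀ y → eval c y ≡ eval c′ y +ₚ s *ₚ eval N y
    eval-c y = trans (eval-+ (pad c′) (λ i → s *ₚ N i) y) (cong₂ _+ₚ_ (eval-pad c′ y) (eval-* s N y))
    c-interpolates : ∀ i → eval c (pts i) ≡ h (pts i)
    c-interpolates fz = begin
      eval c a
        ≡⟨ eval-c a ⟩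
      eval c′ a +ₚ (δ *ₚ Na⁻¹) *ₚ eval N a
        ≡⟨ cong (eval c′ a +ₚ_) (solve 3 (λ u v w → (u :* v) :* w := u :* (w :* v)) refl δ Na⁻¹ (eval N a)) ⟩
      eval c′ a +ₚ δ *ₚ (eval N a *ₚ Na⁻¹)
        ≡⟨ cong (λ v → eval c′ a +ₚ δ *ₚ v) (proj₂ Na-invertible) ⟩
      eval c′ a +ₚ δ *ₚ 1ₚ
        ≡⟨ cong (eval c′ a +ₚ_) (*-identityʳ δ) ⟩
      eval c′ a +ₚ (h a - eval c′ a)
        ≡⟨ x+[y-x]≡y (eval c′ a) (h a) ⟩
      h a ∎
      where
      δ Na⁻¹ : Fp
      δ = h a - eval c′ a
      Na⁻¹ = proj₁ Na-invertible
    c-interpolates (fs i) = begin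
      eval c (bs i)
        ≡⟨ eval-c (bs i) ⟩
      eval c′ (bs i) +ₚ s *ₚ eval N (bs i)
        ≡⟨ cong (λ v → eval c′ (bs i) +ₚ s *ₚ v) (eval-vanishingAt bs i) ⟩
      eval c′ (bs i) +ₚ s *ₚ 0ₚ
        ≡⟨ trans (cong (eval c′ (bs i) +ₚ_) (zeroʳ s)) (+-identityʳ _) ⟩
      eval c′ (bs i)
        ≡⟨ proj₂ IH i ⟩
      h (bs i) ∎

  eval-injective : (c d : Fin p → Fp) → (∀ x → eval c x ≡ eval d x) → ∀ i → c i ≡ d i
  eval-injective = interpolation-unique id id

  eval-surjective : (h : Fp → Fp) → Σ (Fin p → Fp) λ c → ∀ x → eval c x ≡ h x
  eval-surjective = interpolation-exists id id

  -- The binomial expansion of (x + 1)^k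

  pascal : ∀ t j → binom (suc t) (suc j) ≡ binom t j +ₚ binom t (suc j)
  pascal t j = trans (cong [_] (sym (nCk+nC[k+1]≡[n+1]C[k+1] t j))) (sym ([]-+ (t C j) _))

  binomial : ∀ {N} t → t < N → ∀ x → eval {N} (λ i → binom t (toℕ i)) x ≡ (x +ₚ 1ₚ) ^ₚ t
  binomial {suc N} zero    _ x = trans (cong (λ v → 1ₚ +ₚ x *ₚ v) (eval-zero N x))
    (solve 1 (λ x → con 1 :+ x :* con 0 := con 1) refl x)
  binomial {suc N} (suc t) (s≤s t<N) x = begin
    1ₚ +ₚ x *ₚ eval {N} (λ i → binom (suc t) (suc (toℕ i))) x
      ≡⟨ cong (λ v → 1ₚ +ₚ x *ₚ v) (trans (eval-cong {N} (λ i → pascal t (toℕ i)) x)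
           (eval-+ {N} (λ i → binom t (toℕ i)) (λ i → binom t (suc (toℕ i))) x)) ⟩
    1ₚ +ₚ x *ₚ (eval {N} (λ i → binom t (toℕ i)) x +ₚ Y)
      ≡⟨ cong (λ v → 1ₚ +ₚ x *ₚ (v +ₚ Y)) (binomial t t<N x) ⟩
    1ₚ +ₚ x *ₚ (P +ₚ Y)
      ≡⟨ solve 3 (λ x P Y → con 1 :+ x :* (P :+ Y) := x :* P :+ (con 1 :+ x :* Y)) refl x P Y ⟩
    x *ₚ P +ₚ (1ₚ +ₚ x *ₚ Y)
      ≡⟨ cong (x *ₚ P +ₚ_) (binomial t (ℕ.m<n⇒m<1+n t<N) x) ⟩
    x *ₚ P +ₚ P
      ≡⟨ solve 2 (λ x P → x :* P :+ P := (x :+ con 1) :* P) refl x P ⟩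
    (x +ₚ 1ₚ) *ₚ P ∎
    where
    P Y : Fp
    P = (x +ₚ 1ₚ) ^ₚ t
    Y = eval {N} (λ i → binom t (suc (toℕ i))) x

  eval-monomial : ∀ {N} t → t < N → ∀ x → eval {N} (λ i → if toℕ i ℕ.≡ᵇ t then 1ₚ else 0ₚ) x ≡ x ^ₚ t
  eval-monomial {suc N} zero    _ x = trans (cong (λ v → 1ₚ +ₚ x *ₚ v) (eval-zero N x))
    (solve 1 (λ x → con 1 :+ x :* con 0 := con 1) refl x)
  eval-monomial {suc N} (suc t) (s≤s t<N) x = trans (+-identityˡ _) (cong (x *ₚ_) (eval-monomial t t<N x))

  binom-split : ∀ t j → binom t j ≡ (if ⌊ j ℕ.<? t ⌋ then binom t (t ∸ j) else 0ₚ) +ₚ (if j ℕ.≡ᵇ t then 1ₚ else 0ₚ)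
  binom-split t j with j ℕ.<? t | j ℕ.≡ᵇ t in j≡ᵇt
  ... | yes j<t | true  = ⊥-elim (ℕ.<-irrefl (ℕ.≡ᵇ⇒≡ j t (subst T (sym j≡ᵇt) tt)) j<t)
  ... | yes j<t | false = trans (cong [_] (nCk≡nC[n∸k] (ℕ.<⇒≤ j<t))) (sym (+-identityʳ _))
  ... | no _    | true  rewrite ℕ.≡ᵇ⇒≡ j t (subst T (sym j≡ᵇt) tt) = trans (cong [_] (nCn≡1 t)) (sym (+-identityˡ 1ₚ))
  ... | no j≮t  | false = trans (cong [_] (k>n⇒nCk≡0 (ℕ.≤∧≢⇒< (ℕ.≮⇒≥ j≮t) t≢j))) (sym (+-identityˡ 0ₚ))
    where
    t≢j : t ≢ j
    t≢j t≡j = subst T j≡ᵇt (ℕ.≡⇒≡ᵇ j t (sym t≡j))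

  -- the coefficient of x^i in (x + 1)^k - x^k
  Δpow : Fin p → Fin p → Fp
  Δpow i k = if ⌊ i <? k ⌋ then binom (toℕ k) (toℕ k ∸ toℕ i) else 0ₚ

  binomSum≡Σ : ∀ i h → binomSum i h ≡ sumFin (λ k → Δpow i k *ₚ h k)
  binomSum≡Σ i h = sumFin-cong λ k → if-*ʳ ⌊ i <? k ⌋ (h k)
    where
    if-*ʳ : ∀ b {u} v → (if b then u *ₚ v else 0ₚ) ≡ (if b then u else 0ₚ) *ₚ v
    if-*ʳ true  v = refl
    if-*ʳ false v = sym (zeroˡ v)

  [x+1]^k : ∀ (k : Fin p) x → (x +ₚ 1ₚ) ^ₚ toℕ k ≡ x ^ₚ toℕ k +ₚ sumFin (λ i → Δpow i k *ₚ x ^ₚ toℕ i)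
  [x+1]^k k x = begin
    (x +ₚ 1ₚ) ^ₚ toℕ k
      ≡⟨ binomial (toℕ k) (toℕ<n k) x ⟨
    eval {p} (λ i → binom (toℕ k) (toℕ i)) x
      ≡⟨ eval-cong {p} (λ i → binom-split (toℕ k) (toℕ i)) x ⟩
    eval {p} (λ i → Δpow i k +ₚ δ i) x
      ≡⟨ eval-+ (λ i → Δpow i k) δ x ⟩
    eval (λ i → Δpow i k) x +ₚ eval δ x
      ≡⟨ cong₂ _+ₚ_ (eval≡Σ (λ i → Δpow i k) x) (eval-monomial (toℕ k) (toℕ<n k) x) ⟩
    sumFin (λ i → Δpow i k *ₚ x ^ₚ toℕ i) +ₚ x ^ₚ toℕ k
      ≡⟨ +-comm (sumFin (λ i → Δpow i k *ₚ x ^ₚ toℕ i)) _ ⟩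
    x ^ₚ toℕ k +ₚ sumFin (λ i → Δpow i k *ₚ x ^ₚ toℕ i) ∎
    where
    δ : Fin p → Fp
    δ i = if toℕ i ℕ.≡ᵇ toℕ k then 1ₚ else 0ₚ

  eval-+1 : ∀ (d : Fin p → Fp) x → eval d (x +ₚ 1ₚ) ≡ eval d x +ₚ eval (λ i → binomSum i d) x
  eval-+1 d x = begin
    eval d (x +ₚ 1ₚ)
      ≡⟨ eval≡Σ d (x +ₚ 1ₚ) ⟩
    sumFin (λ k → d k *ₚ (x +ₚ 1ₚ) ^ₚ toℕ k)
      ≡⟨ sumFin-cong (λ k → trans (cong (d k *ₚ_) ([x+1]^k k x)) (distribˡ (d k) _ _)) ⟩
    sumFin (λ k → d k *ₚ x ^ₚ toℕ k +ₚ d k *ₚ S k)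
      ≡⟨ sumFin-distrib-+ (λ k → d k *ₚ x ^ₚ toℕ k) (λ k → d k *ₚ S k) ⟩
    sumFin (λ k → d k *ₚ x ^ₚ toℕ k) +ₚ sumFin (λ k → d k *ₚ S k)
      ≡⟨ cong₂ _+ₚ_ (sym (eval≡Σ d x)) reorder ⟩
    eval d x +ₚ eval (λ i → binomSum i d) x ∎
    where
    S : Fin p → Fp
    S k = sumFin (λ i → Δpow i k *ₚ x ^ₚ toℕ i)
    reorder : sumFin (λ k → d k *ₚ S k) ≡ eval (λ i → binomSum i d) x
    reorder = begin
      sumFin (λ k → d k *ₚ S k)
        ≡⟨ sumFin-cong (λ k → *-distribˡ-sumFin (d k) (λ i → Δpow i k *ₚ x ^ₚ toℕ i)) ⟩
      sumFin (λ k → sumFin (λ i → d k *ₚ (Δpow i k *ₚ x ^ₚ toℕ i)))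
        ≡⟨ sumFin-comm (λ k i → d k *ₚ (Δpow i k *ₚ x ^ₚ toℕ i)) ⟩
      sumFin (λ i → sumFin (λ k → d k *ₚ (Δpow i k *ₚ x ^ₚ toℕ i)))
        ≡⟨ sumFin-cong (λ i → sumFin-cong (λ k → solve 3 (λ u v w → u :* (v :* w) := (v :* u) :* w) refl (d k) (Δpow i k) _)) ⟩
      sumFin (λ i → sumFin (λ k → (Δpow i k *ₚ d k) *ₚ x ^ₚ toℕ i))
        ≡⟨ sumFin-cong (λ i → sym (*-distribʳ-sumFin (x ^ₚ toℕ i) (λ k → Δpow i k *ₚ d k))) ⟩
      sumFin (λ i → sumFin (λ k → Δpow i k *ₚ d k) *ₚ x ^ₚ toℕ i)
        ≡⟨ sumFin-cong (λ i → cong (_*ₚ x ^ₚ toℕ i) (binomSum≡Σ i d)) ⟨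
      sumFin (λ i → binomSum i d *ₚ x ^ₚ toℕ i)
        ≡⟨ eval≡Σ (λ i → binomSum i d) x ⟨
      eval (λ i → binomSum i d) x ∎

  -- Algebraic normal forms

  anf : ∀ n → (Vec (Fin p) n → Fp) → Vec Fp n → Fp
  anf n c x = sumMulti n (λ i → c i *ₚ monomial i x)

  sumMulti-cong : ∀ n {f g : Vec (Fin p) n → Fp} → (∀ i → f i ≡ g i) → sumMulti n f ≡ sumMulti n g
  sumMulti-cong zero    f≗g = f≗g []
  sumMulti-cong (suc n) f≗g = sumFin-cong (λ a → sumMulti-cong n (λ r → f≗g (a ∷ r)))

  *-distribˡ-sumMulti : ∀ n c (f : Vec (Fin p) n → Fp) → c *ₚ sumMulti n f ≡ sumMulti n (λ i → c *ₚ f i)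
  *-distribˡ-sumMulti zero    c f = refl
  *-distribˡ-sumMulti (suc n) c f = trans (*-distribˡ-sumFin c (λ a → sumMulti n (λ r → f (a ∷ r)))) (sumFin-cong (λ a → *-distribˡ-sumMulti n c (λ r → f (a ∷ r))))

  sumMulti-comm : ∀ n {k} (f : Fin k → Vec (Fin p) n → Fp) →
                  sumMulti n (λ r → sumFin (λ j → f j r)) ≡ sumFin (λ j → sumMulti n (f j))
  sumMulti-comm zero    f = refl
  sumMulti-comm (suc n) f = trans (sumFin-cong (λ a → sumMulti-comm n (λ j r → f j (a ∷ r))))
    (sumFin-comm (λ a j → sumMulti n (λ r → f j (a ∷ r))))

  anf-cong : ∀ n {c d : Vec (Fin p) n → Fp} → (∀ i → c i ≡ d i) → ∀ x → anf n c x ≡ anf n d x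
  anf-cong n c≗d x = sumMulti-cong n (λ i → cong (_*ₚ monomial i x) (c≗d i))

  anf-∷ : ∀ n (c : Vec (Fin p) (suc n) → Fp) x xs → anf (suc n) c (x ∷ xs) ≡ eval (λ a → anf n (λ r → c (a ∷ r)) xs) x
  anf-∷ n c x xs = trans (sumFin-cong slice) (sym (eval≡Σ (λ a → anf n (λ r → c (a ∷ r)) xs) x))
    where
    slice : ∀ a → sumMulti n (λ r → c (a ∷ r) *ₚ (x ^ₚ toℕ a *ₚ monomial r xs)) ≡ anf n (λ r → c (a ∷ r)) xs *ₚ x ^ₚ toℕ a
    slice a = begin
      sumMulti n (λ r → c (a ∷ r) *ₚ (x ^ₚ toℕ a *ₚ monomial r xs))
        ≡⟨ sumMulti-cong n (λ r → solve 3 (λ u v w → u :* (v :* w) := v :* (u :* w)) refl (c (a ∷ r)) (x ^ₚ toℕ a) _) ⟩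
      sumMulti n (λ r → x ^ₚ toℕ a *ₚ (c (a ∷ r) *ₚ monomial r xs))
        ≡⟨ *-distribˡ-sumMulti n (x ^ₚ toℕ a) _ ⟨
      x ^ₚ toℕ a *ₚ anf n (λ r → c (a ∷ r)) xs
        ≡⟨ *-comm (x ^ₚ toℕ a) _ ⟩
      anf n (λ r → c (a ∷ r)) xs *ₚ x ^ₚ toℕ a ∎

  anf-linear : ∀ n {k} (w : Fin k → Fp) (f : Fin k → Vec (Fin p) n → Fp) xs →
               anf n (λ r → sumFin (λ j → w j *ₚ f j r)) xs ≡ sumFin (λ j → w j *ₚ anf n (f j) xs)
  anf-linear n w f xs = begin
    sumMulti n (λ r → sumFin (λ j → w j *ₚ f j r) *ₚ monomial r xs)
      ≡⟨ sumMulti-cong n (λ r → trans (*-distribʳ-sumFin (monomial r xs) (λ j → w j *ₚ f j r)) (sumFin-cong λ j → *-assoc (w j) (f j r) _)) ⟩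
    sumMulti n (λ r → sumFin (λ j → w j *ₚ (f j r *ₚ monomial r xs)))
      ≡⟨ sumMulti-comm n (λ j r → w j *ₚ (f j r *ₚ monomial r xs)) ⟩
    sumFin (λ j → sumMulti n (λ r → w j *ₚ (f j r *ₚ monomial r xs)))
      ≡⟨ sumFin-cong (λ j → *-distribˡ-sumMulti n (w j) _) ⟨
    sumFin (λ j → w j *ₚ anf n (f j) xs) ∎

  Δ₁-coeff : ∀ {n} → (Vec (Fin p) (suc n) → Fp) → Vec (Fin p) (suc n) → Fp
  Δ₁-coeff c (i ∷ r) = binomSum i (λ k → c (k ∷ r))

  Δ₂-coeff : ∀ {n} → (Vec (Fin p) (suc (suc n)) → Fp) → Vec (Fin p) (suc (suc n)) → Fp
  Δ₂-coeff c (a ∷ r) = Δ₁-coeff (λ r′ → c (a ∷ r′)) r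

  anf-+1₁ : ∀ n (c : Vec (Fin p) (suc n) → Fp) x xs →
            anf (suc n) c (x +ₚ 1ₚ ∷ xs) ≡ anf (suc n) c (x ∷ xs) +ₚ anf (suc n) (Δ₁-coeff c) (x ∷ xs)
  anf-+1₁ n c x xs = begin
    anf (suc n) c (x +ₚ 1ₚ ∷ xs)
      ≡⟨ anf-∷ n c (x +ₚ 1ₚ) xs ⟩
    eval d (x +ₚ 1ₚ)
      ≡⟨ eval-+1 d x ⟩
    eval d x +ₚ eval (λ i → binomSum i d) x
      ≡⟨ cong₂ _+ₚ_ (anf-∷ n c x xs) (trans (anf-∷ n (Δ₁-coeff c) x xs) (sym (eval-cong {p} slice x))) ⟨
    anf (suc n) c (x ∷ xs) +ₚ anf (suc n) (Δ₁-coeff c) (x ∷ xs) ∎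
    where
    d : Fin p → Fp
    d a = anf n (λ r → c (a ∷ r)) xs
    slice : ∀ i → binomSum i d ≡ anf n (λ r → Δ₁-coeff c (i ∷ r)) xs
    slice i = begin
      binomSum i d
        ≡⟨ binomSum≡Σ i d ⟩
      sumFin (λ k → Δpow i k *ₚ d k)
        ≡⟨ anf-linear n (Δpow i) (λ k r → c (k ∷ r)) xs ⟨
      anf n (λ r → sumFin (λ k → Δpow i k *ₚ c (k ∷ r))) xs
        ≡⟨ anf-cong n (λ r → binomSum≡Σ i (λ k → c (k ∷ r))) xs ⟨
      anf n (λ r → Δ₁-coeff c (i ∷ r)) xs ∎

  anf-+1₂ : ∀ n (c : Vec (Fin p) (suc (suc n)) → Fp) x₁ x₂ xs →
            anf (suc (suc n)) c (x₁ ∷ x₂ +ₚ 1ₚ ∷ xs) ≡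
            anf (suc (suc n)) c (x₁ ∷ x₂ ∷ xs) +ₚ anf (suc (suc n)) (Δ₂-coeff c) (x₁ ∷ x₂ ∷ xs)
  anf-+1₂ n c x₁ x₂ xs = begin
    anf (suc (suc n)) c (x₁ ∷ x₂ +ₚ 1ₚ ∷ xs)
      ≡⟨ anf-∷ (suc n) c x₁ (x₂ +ₚ 1ₚ ∷ xs) ⟩
    eval (λ a → anf (suc n) (c₍ a ₎) (x₂ +ₚ 1ₚ ∷ xs)) x₁
      ≡⟨ eval-cong {p} (λ a → anf-+1₁ n (c₍ a ₎) x₂ xs) x₁ ⟩
    eval (λ a → A a +ₚ B a) x₁
      ≡⟨ eval-+ A B x₁ ⟩
    eval A x₁ +ₚ eval B x₁
      ≡⟨ cong₂ _+ₚ_ (anf-∷ (suc n) c x₁ (x₂ ∷ xs)) (anf-∷ (suc n) (Δ₂-coeff c) x₁ (x₂ ∷ xs)) ⟨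
    anf (suc (suc n)) c (x₁ ∷ x₂ ∷ xs) +ₚ anf (suc (suc n)) (Δ₂-coeff c) (x₁ ∷ x₂ ∷ xs) ∎
    where
    c₍_₎ : Fin p → Vec (Fin p) (suc n) → Fp
    c₍ a ₎ r = c (a ∷ r)
    A B : Fin p → Fp
    A a = anf (suc n) c₍ a ₎ (x₂ ∷ xs)
    B a = anf (suc n) (Δ₁-coeff c₍ a ₎) (x₂ ∷ xs)

  anf-injective : ∀ n (c d : Vec (Fin p) n → Fp) → (∀ x → anf n c x ≡ anf n d x) → ∀ i → c i ≡ d i
  anf-injective zero    c d c≗d [] = trans (sym (*-identityʳ (c []))) (trans (c≗d []) (*-identityʳ (d [])))
  anf-injective (suc n) c d c≗d (a ∷ r) = anf-injective n (λ r → c (a ∷ r)) (λ r → d (a ∷ r)) slices-agree r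
    where
    slices-agree : ∀ xs → anf n (λ r → c (a ∷ r)) xs ≡ anf n (λ r → d (a ∷ r)) xs
    slices-agree xs = eval-injective (λ a → anf n (λ r → c (a ∷ r)) xs) (λ a → anf n (λ r → d (a ∷ r)) xs)
      (λ x → trans (sym (anf-∷ n c x xs)) (trans (c≗d (x ∷ xs)) (anf-∷ n d x xs))) a

  anf-exists : ∀ n (h : Vec Fp n → Fp) → Σ (Vec (Fin p) n → Fp) λ c → IsANF c h
  anf-exists zero    h = (λ _ → h []) , λ { [] → sym (*-identityʳ (h [])) }
  anf-exists (suc n) h = c , c-is-anf
    where
    slice : Vec Fp n → Fin p → Fp
    slice xs = proj₁ (eval-surjective (λ x → h (x ∷ xs)))
    c : Vec (Fin p) (suc n) → Fp
    c (a ∷ r) = proj₁ (anf-exists n (λ xs → slice xs a)) r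
    c-is-anf : IsANF c h
    c-is-anf (x ∷ xs) = begin
      h (x ∷ xs)                                  ≡⟨ proj₂ (eval-surjective (λ x → h (x ∷ xs))) x ⟨
      eval (slice xs) x
        ≡⟨ eval-cong {p} (λ a → proj₂ (anf-exists n (λ xs → slice xs a)) xs) x ⟩
      eval (λ a → anf n (λ r → c (a ∷ r)) xs) x   ≡⟨ anf-∷ n c x xs ⟨
      anf (suc n) c (x ∷ xs)                      ∎

  unit : ∀ {n} → Fin n → Vecₚ n
  unit j = 0ᵥ [ j ]≔ 1ₚ

  unit≢0 : ∀ {n} (j : Fin n) → unit j ≢ 0ᵥ
  unit≢0 j unit≡0 = 1≢0 (begin
    1ₚ                 ≡⟨ lookup∘update j 0ᵥ 1ₚ ⟨
    lookup (unit j) j  ≡⟨ cong (λ v → lookup v j) unit≡0 ⟩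
    lookup 0ᵥ j        ≡⟨ lookup-replicate j 0ₚ ⟩
    0ₚ                 ∎)

  dot-zeroˡ : ∀ {n} (v : Vecₚ n) → dot 0ᵥ v ≡ 0ₚ
  dot-zeroˡ []      = refl
  dot-zeroˡ (a ∷ v) = trans (cong₂ _+ₚ_ (zeroˡ a) (dot-zeroˡ v)) (+-identityˡ 0ₚ)

  dot-unit : ∀ {n} (j : Fin n) (v : Vecₚ n) → dot (unit j) v ≡ lookup v j
  dot-unit fz     (a ∷ v) = trans (cong₂ _+ₚ_ (*-identityˡ a) (dot-zeroˡ v)) (+-identityʳ a)
  dot-unit (fs j) (a ∷ v) = trans (cong₂ _+ₚ_ (zeroˡ a) (dot-unit j v)) (+-identityˡ _)

  ≡-by-components : ∀ {n} {u v : Vecₚ n} → (∀ j → dot (unit j) u ≡ dot (unit j) v) → u ≡ v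
  ≡-by-components {u = u} {v} components≡ = begin
    u                   ≡⟨ tabulate∘lookup u ⟨
    tabulate (lookup u)
      ≡⟨ tabulate-cong (λ j → trans (sym (dot-unit j u)) (trans (components≡ j) (dot-unit j v))) ⟩
    tabulate (lookup v) ≡⟨ tabulate∘lookup v ⟩
    v                   ∎

  [a-b]+[c-d]≡[a+c]-[b+d] : ∀ a b c d → (a - b) +ₚ (c - d) ≡ (a +ₚ c) - (b +ₚ d)
  [a-b]+[c-d]≡[a+c]-[b+d] a b c d =
    trans (solve 4 (λ a nb c nd → (a :+ nb) :+ (c :+ nd) := (a :+ c) :+ (nb :+ nd)) refl a (- b) c (- d))
          (cong (a +ₚ c +ₚ_) (-‿+-comm b d))

  dot-sub : ∀ {n} (μ u v : Vecₚ n) → dot μ (u -ᵥ v) ≡ dot μ u - dot μ v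
  dot-sub []      []      []      = sym (-‿inverseʳ 0ₚ)
  dot-sub (c ∷ μ) (a ∷ u) (b ∷ v) = begin
    c *ₚ (a -ₚ b) +ₚ dot μ (u -ᵥ v)
      ≡⟨ cong₂ _+ₚ_ (trans (cong (c *ₚ_) (-ₚ≡- a b)) (x[y-z]≈xy-xz c a b)) (dot-sub μ u v) ⟩
    (c *ₚ a - c *ₚ b) +ₚ (dot μ u - dot μ v)
      ≡⟨ [a-b]+[c-d]≡[a+c]-[b+d] (c *ₚ a) (c *ₚ b) (dot μ u) (dot μ v) ⟩
    (c *ₚ a +ₚ dot μ u) - (c *ₚ b +ₚ dot μ v) ∎

  lin-+₁ : ∀ {n k} x (xs : Vec Fp k) v (vs : Vec (Vecₚ n) k) → lin (x ∷ xs) (v ∷ vs) +ᵥ v ≡ lin (x +ₚ 1ₚ ∷ xs) (v ∷ vs)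
  lin-+₁ x xs v vs = add-once v (lin xs vs)
    where
    add-once : ∀ {n} (v r : Vecₚ n) → ((x ·ᵥ v) +ᵥ r) +ᵥ v ≡ ((x +ₚ 1ₚ) ·ᵥ v) +ᵥ r
    add-once []      []      = refl
    add-once (b ∷ v) (c ∷ r) = cong₂ _∷_ (solve 3 (λ x b c → (x :* b :+ c) :+ b := (x :+ con 1) :* b :+ c) refl x b c) (add-once v r)

  lin-+₂ : ∀ {n k} x₁ x₂ (xs : Vec Fp k) v₁ v₂ (vs : Vec (Vecₚ n) k) →
           lin (x₁ ∷ x₂ ∷ xs) (v₁ ∷ v₂ ∷ vs) +ᵥ v₂ ≡ lin (x₁ ∷ x₂ +ₚ 1ₚ ∷ xs) (v₁ ∷ v₂ ∷ vs)
  lin-+₂ x₁ x₂ xs v₁ v₂ vs =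
    trans (zipWith-assoc +-assoc (x₁ ·ᵥ v₁) (lin (x₂ ∷ xs) (v₂ ∷ vs)) v₂) (cong ((x₁ ·ᵥ v₁) +ᵥ_) (lin-+₁ x₂ xs v₂ vs))

  IsANF-difference : ∀ {n} {c c′ : Vec (Fin p) n → Fp} {h : Vec Fp n → Fp} {x y} → IsANF c h →
                     anf n c y ≡ anf n c x +ₚ anf n c′ x → h y - h x ≡ anf n c′ x
  IsANF-difference {n} {c} {c′} {h} {x} {y} c-anf shift = begin
    h y - h x                                 ≡⟨ cong₂ _-_ (c-anf y) (c-anf x) ⟩
    anf n c y - anf n c x                     ≡⟨ cong (_- anf n c x) shift ⟩
    anf n c x +ₚ anf n c′ x - anf n c x       ≡⟨ xyx⁻¹≈y (anf n c x) (anf n c′ x) ⟩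
    anf n c′ x                                ∎

  comp-Δ₁ : ∀ {n k} (H : Vecₚ n → Vecₚ n) v (vs : Vec (Vecₚ n) k) μ {f} →
            IsANF f (λ x → comp μ H (lin x (v ∷ vs))) → ∀ x → comp μ (Δ v H) (lin x (v ∷ vs)) ≡ anf (suc k) (Δ₁-coeff f) x
  comp-Δ₁ {k = k} H v vs μ {f} f-anf (x ∷ xs) = begin
    comp μ (Δ v H) (lin (x ∷ xs) (v ∷ vs))
      ≡⟨ dot-sub μ _ _ ⟩
    comp μ H (lin (x ∷ xs) (v ∷ vs) +ᵥ v) - comp μ H (lin (x ∷ xs) (v ∷ vs))
      ≡⟨ cong (λ y → comp μ H y - comp μ H (lin (x ∷ xs) (v ∷ vs))) (lin-+₁ x xs v vs) ⟩
    comp μ H (lin (x +ₚ 1ₚ ∷ xs) (v ∷ vs)) - comp μ H (lin (x ∷ xs) (v ∷ vs))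
      ≡⟨ IsANF-difference {c = f} {c′ = Δ₁-coeff f} {x = x ∷ xs} {y = x +ₚ 1ₚ ∷ xs} f-anf (anf-+1₁ k f x xs) ⟩
    anf (suc k) (Δ₁-coeff f) (x ∷ xs) ∎

  comp-Δ₂ : ∀ {n k} (H : Vecₚ n → Vecₚ n) v₁ v₂ (vs : Vec (Vecₚ n) k) μ {g} →
            IsANF g (λ x → comp μ H (lin x (v₁ ∷ v₂ ∷ vs))) →
            ∀ x → comp μ (Δ v₂ H) (lin x (v₁ ∷ v₂ ∷ vs)) ≡ anf (suc (suc k)) (Δ₂-coeff g) x
  comp-Δ₂ {n} {k} H v₁ v₂ vs μ {g} g-anf (x₁ ∷ x₂ ∷ xs) = begin
    comp μ (Δ v₂ H) (lin X e)
      ≡⟨ dot-sub μ _ _ ⟩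
    comp μ H (lin X e +ᵥ v₂) - comp μ H (lin X e)
      ≡⟨ cong (λ y → comp μ H y - comp μ H (lin X e)) (lin-+₂ x₁ x₂ xs v₁ v₂ vs) ⟩
    comp μ H (lin (x₁ ∷ x₂ +ₚ 1ₚ ∷ xs) e) - comp μ H (lin X e)
      ≡⟨ IsANF-difference {c = g} {c′ = Δ₂-coeff g} {x = X} {y = x₁ ∷ x₂ +ₚ 1ₚ ∷ xs} g-anf (anf-+1₂ k g x₁ x₂ xs) ⟩
    anf (suc (suc k)) (Δ₂-coeff g) X ∎
    where
    X : Vec Fp (suc (suc k))
    X = x₁ ∷ x₂ ∷ xs
    e : Vec (Vecₚ n) (suc (suc k))
    e = v₁ ∷ v₂ ∷ vs

  toℕ-pm1 : toℕ pm1 ≡ p ∸ 1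
  toℕ-pm1 = trans (toℕ-[] (p ∸ 1)) (m<n⇒m%n≡m (ℕ.m≤pred[n]⇒suc[m]≤n ℕ.≤-refl))

  ≡pm1⊎< : ∀ (i : Fin p) → i ≡ pm1 ⊎ suc (toℕ i) < p
  ≡pm1⊎< i with suc (toℕ i) ℕ.<? p
  ... | yes i+1<p = inj₂ i+1<p
  ... | no  i+1≮p = inj₁ (toℕ-injective (trans (cong (_∸ 1) (ℕ.≤-antisym (toℕ<n i) (ℕ.≮⇒≥ i+1≮p))) (sym toℕ-pm1)))

  binomSum-pm1 : ∀ h → binomSum pm1 h ≡ 0ₚ
  binomSum-pm1 h = begin
    binomSum pm1 h
      ≡⟨ binomSum≡Σ pm1 h ⟩
    sumFin (λ k → Δpow pm1 k *ₚ h k)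
      ≡⟨ sumFin-cong (λ k → trans (cong (_*ₚ h k) (Δpow-pm1 k)) (zeroˡ (h k))) ⟩
    sumFin {p} (λ _ → 0ₚ)
      ≡⟨ sumFin-zero p ⟩
    0ₚ ∎
    where
    Δpow-pm1 : ∀ k → Δpow pm1 k ≡ 0ₚ
    Δpow-pm1 k with pm1 <? k
    ... | yes pm1<k = ⊥-elim (ℕ.<-irrefl refl (ℕ.<-≤-trans (toℕ<n k)
                        (subst (ℕ._≤ toℕ k) (trans (cong suc toℕ-pm1) (ℕ.suc-pred p)) pm1<k)))
    ... | no  _     = refl

  Conditions : ∀ {m} (f g : Vec (Fin p) (suc (suc m)) → Fp) → Set
  Conditions {m} f g =
    (∀ (i₁ i₂ : Fin p) (rest : Vec (Fin p) m) → suc (toℕ i₁) < p → suc (toℕ i₂) < p →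
       binomSum i₁ (λ k → f (k ∷ i₂ ∷ rest)) ≡ binomSum i₂ (λ k → g (i₁ ∷ k ∷ rest)))
    ×
    (∀ (j : Fin p) (rest : Vec (Fin p) m) → suc (toℕ j) < p →
       (binomSum j (λ k → f (k ∷ pm1 ∷ rest)) ≡ binomSum j (λ k → g (pm1 ∷ k ∷ rest)))
       × (binomSum j (λ k → g (pm1 ∷ k ∷ rest)) ≡ 0ₚ))

  -- The conditions are Δ₁-coeff f ≡ Δ₂-coeff g with the entries at index p - 1, where binomSum is empty, written out.
  conditions⇔Δ-coeffs-agree : ∀ {m} (f g : Vec (Fin p) (suc (suc m)) → Fp) →
                              Conditions f g ⇔ (∀ i → Δ₁-coeff f i ≡ Δ₂-coeff g i)
  conditions⇔Δ-coeffs-agree f g = mk⇔ conditions⇒agree agree⇒conditions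
    where
    conditions⇒agree : Conditions f g → ∀ i → Δ₁-coeff f i ≡ Δ₂-coeff g i
    conditions⇒agree (interior , boundary) (i₁ ∷ i₂ ∷ rest) with ≡pm1⊎< i₁ | ≡pm1⊎< i₂
    ... | inj₂ i₁<p | inj₂ i₂<p = interior i₁ i₂ rest i₁<p i₂<p
    ... | inj₂ i₁<p | inj₁ refl =
      trans (proj₁ (boundary i₁ rest i₁<p)) (trans (proj₂ (boundary i₁ rest i₁<p)) (sym (binomSum-pm1 _)))
    ... | inj₁ refl | inj₂ i₂<p = trans (binomSum-pm1 _) (sym (proj₂ (boundary i₂ rest i₂<p)))
    ... | inj₁ refl | inj₁ refl = trans (binomSum-pm1 _) (sym (binomSum-pm1 _))
    agree⇒conditions : (∀ i → Δ₁-coeff f i ≡ Δ₂-coeff g i) → Conditions f g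
    agree⇒conditions agree =
      (λ i₁ i₂ rest _ _ → agree (i₁ ∷ i₂ ∷ rest)) ,
      (λ j rest _ → trans (agree (j ∷ pm1 ∷ rest)) (trans (binomSum-pm1 _) (sym (g-vanishes j rest))) , g-vanishes j rest)
      where
      g-vanishes : ∀ j rest → binomSum j (λ k → g (pm1 ∷ k ∷ rest)) ≡ 0ₚ
      g-vanishes j rest = trans (sym (agree (pm1 ∷ j ∷ rest))) (binomSum-pm1 _)

  module _ {m : ℕ} (F G : Vecₚ (suc (suc m)) → Vecₚ (suc (suc m)))
           (e₀ e₁ : Vecₚ (suc (suc m))) (es : Vec (Vecₚ (suc (suc m))) m) where

    private
      e : Vec (Vecₚ (suc (suc m))) (suc (suc m))
      e = e₀ ∷ e₁ ∷ es

    ANF-conditions : Vecₚ (suc (suc m)) → Set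
    ANF-conditions μ = ∀ (f g : Vec (Fin p) (suc (suc m)) → Fp) →
      IsANF f (λ x → comp μ F (lin x e)) → IsANF g (λ x → comp μ G (lin x e)) → Conditions f g

    comp-Δ-agree⇔Δ-coeffs-agree : ∀ μ {f g} → IsANF f (λ x → comp μ F (lin x e)) → IsANF g (λ x → comp μ G (lin x e)) →
      (∀ x → comp μ (Δ e₀ F) (lin x e) ≡ comp μ (Δ e₁ G) (lin x e)) ⇔ (∀ i → Δ₁-coeff f i ≡ Δ₂-coeff g i)
    comp-Δ-agree⇔Δ-coeffs-agree μ {f} {g} f-anf g-anf = mk⇔
      (λ agree → anf-injective _ (Δ₁-coeff f) (Δ₂-coeff g) λ x → trans (sym (ΔF x)) (trans (agree x) (ΔG x)))
      (λ coeffs x → trans (ΔF x) (trans (anf-cong _ coeffs x) (sym (ΔG x))))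
      where
      ΔF : ∀ x → comp μ (Δ e₀ F) (lin x e) ≡ anf (suc (suc m)) (Δ₁-coeff f) x
      ΔF = comp-Δ₁ F e₀ (e₁ ∷ es) μ {f} f-anf
      ΔG : ∀ x → comp μ (Δ e₁ G) (lin x e) ≡ anf (suc (suc m)) (Δ₂-coeff g) x
      ΔG = comp-Δ₂ G e₀ e₁ es μ {g} g-anf

    Δ-agree⇒conditions : (∀ x → Δ e₀ F (lin x e) ≡ Δ e₁ G (lin x e)) → ∀ μ → ANF-conditions μ
    Δ-agree⇒conditions ΔF≡ΔG μ f g f-anf g-anf =
      Equivalence.from (conditions⇔Δ-coeffs-agree f g)
        (Equivalence.to (comp-Δ-agree⇔Δ-coeffs-agree μ f-anf g-anf) (cong (dot μ) ∘ ΔF≡ΔG))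

    conditions⇒Δ-agree : (∀ j → ANF-conditions (unit j)) → ∀ x → Δ e₀ F (lin x e) ≡ Δ e₁ G (lin x e)
    conditions⇒Δ-agree conditions x = ≡-by-components λ j →
      let f , f-anf = anf-exists _ (λ x → comp (unit j) F (lin x e))
          g , g-anf = anf-exists _ (λ x → comp (unit j) G (lin x e))
      in Equivalence.from (comp-Δ-agree⇔Δ-coeffs-agree (unit j) f-anf g-anf)
           (Equivalence.to (conditions⇔Δ-coeffs-agree f g) (conditions j f g f-anf g-anf)) x

theorem3 : (p : ℕ) (pr : Prime p) (m : ℕ) → let open FpOps p pr in
    (F G : Vecₚ (suc (suc m)) → Vecₚ (suc (suc m)))
    (e : Vec (Vecₚ (suc (suc m))) (suc (suc m))) → IsBasis e →
    ((∀ (x : Vec Fp (suc (suc m))) → Δ (lookup e fz) F (lin x e) ≡ Δ (lookup e (fs fz)) G (lin x e))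
     ⇔
     (∀ (μ : Vecₚ (suc (suc m))) → μ ≢ 0ᵥ →
        ∀ (f g : Vec (Fin p) (suc (suc m)) → Fp) →
        IsANF f (λ x → comp μ F (lin x e)) →
        IsANF g (λ x → comp μ G (lin x e)) →
        ((∀ (i₁ i₂ : Fin p) (rest : Vec (Fin p) m) → suc (toℕ i₁) < p → suc (toℕ i₂) < p →
            binomSum i₁ (λ k → f (k ∷ i₂ ∷ rest)) ≡ binomSum i₂ (λ k → g (i₁ ∷ k ∷ rest)))
         ×
         (∀ (j : Fin p) (rest : Vec (Fin p) m) → suc (toℕ j) < p →
            (binomSum j (λ k → f (k ∷ pm1 ∷ rest)) ≡ binomSum j (λ k → g (pm1 ∷ k ∷ rest)))
            × (binomSum j (λ k → g (pm1 ∷ k ∷ rest)) ≡ 0ₚ)))))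
theorem3 p pr m F G (e₀ ∷ e₁ ∷ es) _ = mk⇔
  (λ ΔF≡ΔG μ _ → Δ-agree⇒conditions p pr F G e₀ e₁ es ΔF≡ΔG μ)
  (λ conditions → conditions⇒Δ-agree p pr F G e₀ e₁ es λ j → conditions (unit p pr j) (unit≢0 p pr j))
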